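{- Let $K$ be a number field and $j_{CV}\in K\setminus\{0,1728\}$. Let $j\in K$ satisfy $2^{ -18}\frac{j(j-1536)^3}{j-1728}=j_{CV}$, and let $y_1,y_2,y_3$ be distinct algebraic numbers with $(y-y_1)(y-y_2)(y-y_3)\in K[y]$ such that the $j$-invariant of the quadruple $\{y_1,y_2,y_3,\infty\}$ equals $j_{CV}$. Then there exists a quartic $f\in K[x]$ with $C_f=\{y_1,y_2,y_3\}$ whose critical points have $j$-invariant $j$ (i.e. the cubic curve $z^2=f'(x)$ has $j$-invariant $j$).
   Context: $C_f$ is the multiset of finite critical values of $f$ (values of $f$ at roots of $f'$). The $j$-invariant of a quadruple $\{y_1,y_2,y_3,\infty\}$ is the $j$-invariant of the curve $z^2=(y-y_1)(y-y_2)(y-y_3)$. In the paper, the reduced Hurwitz space of quartic polynomials is identified with $\mathbb{P}^1$ via the $j$-invariant $j$ of the critical points $\{x_1,x_2,x_3,\infty\}$ of a quartic, and its map to the $j$-line of critical values is $j\mapsto 2^{ -18}\frac{j(j-1536)^3}{j-1728}$; the statement above is the lemma expressed in these coordinates. -}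

module Defs where

open import Level using (Level; _⊔_) renaming (suc to lsuc)
open import Algebra.Bundles using (CommutativeRing)
open import Data.Nat as ℕ using (ℕ; zero; suc)
open import Data.Integer as ℤ using (ℤ; +_; -[1+_])
open import Data.Rational as ℚ using (ℚ; ↥_; ↧ₙ_)
open import Data.Fin using (Fin)
import Data.Fin as Fin
open import Data.Product using (Σ; _×_; _,_)
open import Relation.Nullary using (¬_)

-- A commutative ring with 0 ≠ 1 in which every nonzero element has an
-- inverse; the inverse is packaged as a total function whose value at 0
-- is irrelevant.

record Field (c ℓ : Level) : Set (lsuc (c ⊔ ℓ)) where
  field
    commutativeRing : CommutativeRing c ℓ
  open CommutativeRing commutativeRing public
  field
    _⁻¹        : Carrier → Carrier
    ⁻¹-inverse : ∀ x → ¬ (x ≈ 0#) → (x * (x ⁻¹)) ≈ 1#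
    0≉1        : ¬ (0# ≈ 1#)

module FieldOps {c ℓ : Level} (F : Field c ℓ) where
  open Field F

  fromℕ : ℕ → Carrier
  fromℕ zero    = 0#
  fromℕ (suc n) = 1# + fromℕ n

  fromℤ : ℤ → Carrier
  fromℤ (+ n)      = fromℕ n
  fromℤ -[1+ n ]   = - fromℕ (suc n)

  -- the image of a rational number p/q (meaningful in characteristic 0)
  fromℚ : ℚ → Carrier
  fromℚ q = fromℤ (↥ q) * (fromℕ (↧ₙ q) ⁻¹)

  sumFin : (n : ℕ) → (Fin n → Carrier) → Carrier
  sumFin zero    v = 0#
  sumFin (suc n) v = v Fin.zero + sumFin n (λ i → v (Fin.suc i))

  sq : Carrier → Carrier
  sq x = x * x

  cube : Carrier → Carrier
  cube x = x * x * x

  disc : Carrier → Carrier → Carrier → Carrier → Carrier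
  disc α β γ δ =
    sq β * sq γ - fromℕ 4 * α * cube γ - fromℕ 4 * cube β * δ
    - fromℕ 27 * sq α * sq δ + fromℕ 18 * α * β * γ * δ

  -- "the cubic α x³ + β x² + γ x + δ has three distinct roots and the
  --  curve z² = α x³ + β x² + γ x + δ has j-invariant j", i.e.
  --  j = 256 (β² − 3αγ)³ / (α² Δ) with Δ ≠ 0.
  HasJInvariant : Carrier → Carrier → Carrier → Carrier → Carrier → Set ℓ
  HasJInvariant α β γ δ j =
    ¬ (disc α β γ δ ≈ 0#) ×
    (j * sq α * disc α β γ δ ≈ fromℕ 256 * cube (sq β - fromℕ 3 * α * γ))

  -- The multiset C_f of values f(xᵢ) at the roots xᵢ of f' (with
  -- multiplicity) is the multiset of eigenvalues of multiplication by f
  -- on the 3-dimensional algebra K[x]/(f'); its characteristic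
  -- polynomial ∏ (y − f(xᵢ)) is computed below.

  record Triple : Set c where
    constructor ⟨_,_,_⟩
    field t₀ t₁ t₂ : Carrier

  module _ (a₄ a₃ a₂ a₁ a₀ : Carrier) where
    -- monic f'/(4a₄) = x³ + p x² + q x + r
    private
      lc⁻¹ : Carrier
      lc⁻¹ = (fromℕ 4 * a₄) ⁻¹
      p q r : Carrier
      p = fromℕ 3 * a₃ * lc⁻¹
      q = fromℕ 2 * a₂ * lc⁻¹
      r = a₁ * lc⁻¹

      -- multiplication by x on K[x]/(f'), basis 1, x, x²
      mulX : Triple → Triple
      mulX ⟨ c₀ , c₁ , c₂ ⟩ = ⟨ - (r * c₂) , c₀ - q * c₂ , c₁ - p * c₂ ⟩

      scale : Carrier → Triple → Triple
      scale k ⟨ c₀ , c₁ , c₂ ⟩ = ⟨ k * c₀ , k * c₁ , k * c₂ ⟩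

      add : Triple → Triple → Triple
      add ⟨ c₀ , c₁ , c₂ ⟩ ⟨ d₀ , d₁ , d₂ ⟩ = ⟨ c₀ + d₀ , c₁ + d₁ , c₂ + d₂ ⟩

      mulF : Triple → Triple
      mulF v =
        let v₁ = mulX v ; v₂ = mulX v₁ ; v₃ = mulX v₂ ; v₄ = mulX v₃ in
        add (scale a₀ v) (add (scale a₁ v₁) (add (scale a₂ v₂)
          (add (scale a₃ v₃) (scale a₄ v₄))))

      col₀ col₁ col₂ : Triple
      col₀ = mulF ⟨ 1# , 0# , 0# ⟩
      col₁ = mulF ⟨ 0# , 1# , 0# ⟩
      col₂ = mulF ⟨ 0# , 0# , 1# ⟩

      m : Fin 3 → Fin 3 → Carrier
      m i j = entry i (col j)
        where
          col : Fin 3 → Triple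
          col Fin.zero = col₀
          col (Fin.suc Fin.zero) = col₁
          col (Fin.suc (Fin.suc Fin.zero)) = col₂
          entry : Fin 3 → Triple → Carrier
          entry Fin.zero t = Triple.t₀ t
          entry (Fin.suc Fin.zero) t = Triple.t₁ t
          entry (Fin.suc (Fin.suc Fin.zero)) t = Triple.t₂ t

      m00 m01 m02 m10 m11 m12 m20 m21 m22 : Carrier
      m00 = m Fin.zero Fin.zero
      m01 = m Fin.zero (Fin.suc Fin.zero)
      m02 = m Fin.zero (Fin.suc (Fin.suc Fin.zero))
      m10 = m (Fin.suc Fin.zero) Fin.zero
      m11 = m (Fin.suc Fin.zero) (Fin.suc Fin.zero)
      m12 = m (Fin.suc Fin.zero) (Fin.suc (Fin.suc Fin.zero))
      m20 = m (Fin.suc (Fin.suc Fin.zero)) Fin.zero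
      m21 = m (Fin.suc (Fin.suc Fin.zero)) (Fin.suc Fin.zero)
      m22 = m (Fin.suc (Fin.suc Fin.zero)) (Fin.suc (Fin.suc Fin.zero))

    -- ∏ (y − f(xᵢ)) = y³ + cvA y² + cvB y + cvC
    -- (char. polynomial y³ − tr y² + E₂ y − det of the matrix of mulF)
    cvA cvB cvC : Carrier
    cvA = - (m00 + m11 + m22)
    cvB = (m00 * m11 - m01 * m10) + (m00 * m22 - m02 * m20)
          + (m11 * m22 - m12 * m21)
    cvC = - (m00 * (m11 * m22 - m12 * m21) - m01 * (m10 * m22 - m12 * m20)
             + m02 * (m10 * m21 - m11 * m20))

record NumberField (c ℓ : Level) : Set (lsuc (c ⊔ ℓ)) where
  field
    field′ : Field c ℓ
  open Field field′ public
  open FieldOps field′ public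
  field
    charZero  : ∀ n → ¬ (fromℕ (suc n) ≈ 0#)
    dim       : ℕ
    basis     : Fin dim → Carrier
    spanning  : ∀ x → Σ (Fin dim → ℚ) λ λs →
                  x ≈ sumFin dim (λ i → fromℚ (λs i) * basis i)

-- Put A = −3j(j − 1728) and B = 2j(j − 1728)², so that z² = x³ + A x + B has
-- j-invariant j, and f₀ = x⁴ + 2A x² + 4B x, whose critical points are the roots
-- of x³ + A x + B.  The hypothesis relating j and j_CV says precisely that the
-- critical values of f₀ have j-invariant j_CV.  Two monic cubics with the same
-- j-invariant j_CV ∉ {0, 1728} are related by an affine change y ↦ L y + M: the
-- j-invariant fixes Q²/P³ for the Tschirnhaus invariants P, Q, which scale like
-- L², L³, and a monic cubic is determined by its y²-coefficient, P and Q.  So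
-- f = L f₀ + M has the prescribed critical values and the critical points of f₀.

module Submission where

open import Defs
open import Level using (Level)
open import Algebra.Solver.Ring.AlmostCommutativeRing
  using (_-Raw-AlmostCommutative⟶_; fromCommutativeRing)
open import Data.Nat as ℕ using (ℕ; zero; suc)
open import Data.Nat.Properties using (+-suc)
open import Data.Integer as ℤ using (ℤ; +_; -[1+_])
import Data.Integer.Properties as ℤ
import Data.Sign as Sign
import Data.Maybe as Maybe
open import Data.Product using (Σ; _×_; _,_; proj₁; proj₂)
open import Data.Fin using (#_)
open import Data.Vec using (Vec; []; _∷_)
open import Data.Vec.Relation.Binary.Pointwise.Inductive as Pointwise
  using (Pointwise; _∷_)
open import Function using (_∘_)
open import Relation.Binary.Consequences using (dec⇒weaklyDec)
import Relation.Binary.PropositionalEquality as ≡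
open import Relation.Nullary using (¬_)

-- Formulas are written once over a ring signature and instantiated both at field
-- elements and at solver polynomials; sq, cube, disc and CriticalValues copy Defs
-- so that evaluating their polynomial versions gives the Defs terms definitionally.
record RingSyntax {a} (X : Set a) : Set a where
  infixl 6 _+_ _-_
  infixl 7 _*_
  infix  8 -_
  field
    _+_ _*_ : X → X → X
    -_      : X → X
    lit     : ℕ → X

  _-_ : X → X → X
  x - y = x + - y

module Formulas {a} {X : Set a} (R : RingSyntax X) where
  open RingSyntax R

  sq cube : X → X
  sq x   = x * x
  cube x = x * x * x

  disc : X → X → X → X → X
  disc α β γ δ =
    sq β * sq γ - lit 4 * α * cube γ - lit 4 * cube β * δ
    - lit 27 * sq α * sq δ + lit 18 * α * β * γ * δ

  -- 27 α² f((t − β) / (3α)) = t³ + 3 P t + Q  for  f = α x³ + β x² + γ x + δ.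
  tschirnhausP : X → X → X → X
  tschirnhausP α β γ = lit 3 * α * γ - sq β

  tschirnhausQ : X → X → X → X → X
  tschirnhausQ α β γ δ = lit 2 * cube β - lit 9 * α * β * γ + lit 27 * sq α * δ

  discPQ : X → X → X
  discPQ P Q = lit 4 * cube P + sq Q

  -- (y − M)³ + a L (y − M)² + b L² (y − M) + c L³, whose roots are the
  -- images under v ↦ L v + M of the roots of y³ + a y² + b y + c.
  affineA : X → X → X → X
  affineA L M a = L * a - lit 3 * M

  affineB : X → X → X → X → X
  affineB L M a b = lit 3 * sq M - lit 2 * a * L * M + b * sq L

  affineC : X → X → X → X → X → X
  affineC L M a b c = - cube M + a * L * sq M - b * sq L * M + c * cube L

  weierstrassA weierstrassB : X → X
  weierstrassA j = - (lit 3 * j * (j - lit 1728))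
  weierstrassB j = lit 2 * j * sq (j - lit 1728)

  -- y³ + depressedCvA y² + depressedCvB y + depressedCvC has as roots the
  -- critical values of x⁴ + 2 A x² + 4 B x.
  depressedCvA depressedCvB depressedCvC : X → X → X
  depressedCvA A B = lit 2 * sq A
  depressedCvB A B = sq (sq A) + lit 18 * A * sq B
  depressedCvC A B = lit 2 * cube A * sq B + lit 27 * sq (sq B)

  -- Defs.cvA, cvB, cvC with the coefficients p, q, r of the monic f′ / (4 a₄)
  -- as parameters, since the solver cannot see through the inverse Defs uses.
  module CriticalValues (p q r a₄ a₃ a₂ a₁ a₀ : X) where
    private
      X³ : Set a
      X³ = X × X × X

      mulX : X³ → X³
      mulX (c₀ , c₁ , c₂) = - (r * c₂) , c₀ - q * c₂ , c₁ - p * c₂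

      scale : X → X³ → X³
      scale k (c₀ , c₁ , c₂) = k * c₀ , k * c₁ , k * c₂

      add : X³ → X³ → X³
      add (c₀ , c₁ , c₂) (d₀ , d₁ , d₂) = c₀ + d₀ , c₁ + d₁ , c₂ + d₂

      mulF : X³ → X³
      mulF v =
        let v₁ = mulX v ; v₂ = mulX v₁ ; v₃ = mulX v₂ ; v₄ = mulX v₃ in
        add (scale a₀ v) (add (scale a₁ v₁) (add (scale a₂ v₂)
          (add (scale a₃ v₃) (scale a₄ v₄))))

      col₀ col₁ col₂ : X³
      col₀ = mulF (lit 1 , lit 0 , lit 0)
      col₁ = mulF (lit 0 , lit 1 , lit 0)
      col₂ = mulF (lit 0 , lit 0 , lit 1)

      row₀ row₁ row₂ : X³ → X
      row₀ = proj₁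
      row₁ v = proj₁ (proj₂ v)
      row₂ v = proj₂ (proj₂ v)

      m00 m01 m02 m10 m11 m12 m20 m21 m22 : X
      m00 = row₀ col₀
      m01 = row₀ col₁
      m02 = row₀ col₂
      m10 = row₁ col₀
      m11 = row₁ col₁
      m12 = row₁ col₂
      m20 = row₂ col₀
      m21 = row₂ col₁
      m22 = row₂ col₂

    cvA cvB cvC : X
    cvA = - (m00 + m11 + m22)
    cvB = (m00 * m11 - m01 * m10) + (m00 * m22 - m02 * m20)
          + (m11 * m22 - m12 * m21)
    cvC = - (m00 * (m11 * m22 - m12 * m21) - m01 * (m10 * m22 - m12 * m20)
             + m02 * (m10 * m21 - m11 * m20))

NonzeroNumeral : ∀ {c ℓ} → Field c ℓ → ℕ → Set ℓ
NonzeroNumeral F n = ¬ fromℕ n ≈ 0#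
  where
  open Field F
  open FieldOps F

module FieldProperties {c ℓ : Level} (F : Field c ℓ) where
  open Field F
  open import Algebra.Properties.Group +-group using (x∙y⁻¹≈ε⇒x≈y; x≈y⇒x∙y⁻¹≈ε)
  open import Algebra.Properties.Ring ring using (x[y-z]≈xy-xz)
  open import Algebra.Properties.Semiring.Exp semiring using (_^_)
  open import Relation.Binary.Reasoning.Setoid setoid

  by-combination : ∀ {x y k u v} → x ≈ y + k * (u - v) → u ≈ v → x ≈ y
  by-combination {x} {y} {k} {u} {v} x≈ u≈v = begin
    x                ≈⟨ x≈ ⟩
    y + k * (u - v)  ≈⟨ +-congˡ (*-congˡ (x≈y⇒x∙y⁻¹≈ε u≈v)) ⟩
    y + k * 0#       ≈⟨ +-congˡ (zeroʳ k) ⟩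
    y + 0#           ≈⟨ +-identityʳ y ⟩
    y                ∎

  by-combination₂ : ∀ {x y k u v k′ u′ v′} →
    x ≈ y + k * (u - v) + k′ * (u′ - v′) → u ≈ v → u′ ≈ v′ → x ≈ y
  by-combination₂ x≈ u≈v u′≈v′ = by-combination (by-combination x≈ u′≈v′) u≈v

  by-combination₃ : ∀ {x y k u v k′ u′ v′ k″ u″ v″} →
    x ≈ y + k * (u - v) + k′ * (u′ - v′) + k″ * (u″ - v″) →
    u ≈ v → u′ ≈ v′ → u″ ≈ v″ → x ≈ y
  by-combination₃ x≈ u≈v u′≈v′ u″≈v″ =
    by-combination₂ (by-combination x≈ u″≈v″) u≈v u′≈v′

  x*y≈0⇒y≈0 : ∀ {x y} → ¬ x ≈ 0# → x * y ≈ 0# → y ≈ 0#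
  x*y≈0⇒y≈0 {x} {y} x≉0 xy≈0 = begin
    y                  ≈⟨ sym (*-identityˡ y) ⟩
    1# * y             ≈⟨ *-congʳ (sym (⁻¹-inverse x x≉0)) ⟩
    x * x ⁻¹ * y       ≈⟨ *-congʳ (*-comm x (x ⁻¹)) ⟩
    x ⁻¹ * x * y       ≈⟨ *-assoc (x ⁻¹) x y ⟩
    x ⁻¹ * (x * y)     ≈⟨ *-congˡ xy≈0 ⟩
    x ⁻¹ * 0#          ≈⟨ zeroʳ (x ⁻¹) ⟩
    0#                 ∎

  *-nonzero : ∀ {x y} → ¬ x ≈ 0# → ¬ y ≈ 0# → ¬ x * y ≈ 0#
  *-nonzero x≉0 y≉0 xy≈0 = y≉0 (x*y≈0⇒y≈0 x≉0 xy≈0)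

  *-cancelˡ : ∀ {x u v} → ¬ x ≈ 0# → x * u ≈ x * v → u ≈ v
  *-cancelˡ {x} {u} {v} x≉0 xu≈xv = x∙y⁻¹≈ε⇒x≈y u v
    (x*y≈0⇒y≈0 x≉0 (trans (x[y-z]≈xy-xz x u v) (x≈y⇒x∙y⁻¹≈ε xu≈xv)))

  sq-nonzero : ∀ {x} → ¬ x ≈ 0# → ¬ x * x ≈ 0#
  sq-nonzero x≉0 = *-nonzero x≉0 x≉0

  cube-nonzero : ∀ {x} → ¬ x ≈ 0# → ¬ x * x * x ≈ 0#
  cube-nonzero x≉0 = *-nonzero (sq-nonzero x≉0) x≉0

  ^-nonzero : ∀ {x} → ¬ x ≈ 0# → ∀ n → ¬ x ^ n ≈ 0#
  ^-nonzero x≉0 zero    1≈0 = 0≉1 (sym 1≈0)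
  ^-nonzero x≉0 (suc n)     = *-nonzero x≉0 (^-nonzero x≉0 n)

  x≉y⇒x-y≉0 : ∀ {x y} → ¬ x ≈ y → ¬ x - y ≈ 0#
  x≉y⇒x-y≉0 x≉y x-y≈0 = x≉y (x∙y⁻¹≈ε⇒x≈y _ _ x-y≈0)

module FieldSolver {c ℓ : Level} (F : Field c ℓ) where
  open Field F
  open FieldOps F
  open import Algebra.Properties.Ring ring using (-‿distribˡ-*; -‿distribʳ-*)
  open import Algebra.Properties.Group +-group using (ε⁻¹≈ε; ⁻¹-involutive)
  open import Algebra.Properties.AbelianGroup +-abelianGroup using (⁻¹-∙-comm)
  open import Algebra.Properties.CommutativeSemigroup +-commutativeSemigroup
    using (interchange)
  open import Relation.Binary.Reasoning.Setoid setoid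
  open import Algebra.Properties.Semiring.Exp semiring using (^-congˡ)

  fromℕ-+ : ∀ m n → fromℕ (m ℕ.+ n) ≈ fromℕ m + fromℕ n
  fromℕ-+ zero    n = sym (+-identityˡ _)
  fromℕ-+ (suc m) n = trans (+-congˡ (fromℕ-+ m n)) (sym (+-assoc _ _ _))

  fromℕ-* : ∀ m n → fromℕ (m ℕ.* n) ≈ fromℕ m * fromℕ n
  fromℕ-* zero    n = sym (zeroˡ _)
  fromℕ-* (suc m) n = begin
    fromℕ (n ℕ.+ m ℕ.* n)            ≈⟨ fromℕ-+ n (m ℕ.* n) ⟩
    fromℕ n + fromℕ (m ℕ.* n)        ≈⟨ +-cong (sym (*-identityˡ _)) (fromℕ-* m n) ⟩
    1# * fromℕ n + fromℕ m * fromℕ n ≈⟨ sym (distribʳ _ _ _) ⟩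
    (1# + fromℕ m) * fromℕ n         ∎

  [x+y]-[x+z]≈y-z : ∀ x y z → (x + y) - (x + z) ≈ y - z
  [x+y]-[x+z]≈y-z x y z = begin
    (x + y) + - (x + z)   ≈⟨ +-congˡ (sym (⁻¹-∙-comm x z)) ⟩
    (x + y) + (- x + - z) ≈⟨ interchange x y (- x) (- z) ⟩
    (x - x) + (y - z)     ≈⟨ +-congʳ (-‿inverseʳ x) ⟩
    0# + (y - z)          ≈⟨ +-identityˡ _ ⟩
    y - z                 ∎

  fromℤ-⊖ : ∀ m n → fromℤ (m ℤ.⊖ n) ≈ fromℕ m - fromℕ n
  fromℤ-⊖ zero    zero    = sym (-‿inverseʳ 0#)
  fromℤ-⊖ zero    (suc n) = sym (+-identityˡ _)
  fromℤ-⊖ (suc m) zero    = sym (trans (+-congˡ ε⁻¹≈ε) (+-identityʳ _))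
  fromℤ-⊖ (suc m) (suc n) = begin
    fromℤ (suc m ℤ.⊖ suc n)           ≡⟨ ≡.cong fromℤ (ℤ.[1+m]⊖[1+n]≡m⊖n m n) ⟩
    fromℤ (m ℤ.⊖ n)                   ≈⟨ fromℤ-⊖ m n ⟩
    fromℕ m - fromℕ n                 ≈⟨ sym ([x+y]-[x+z]≈y-z 1# (fromℕ m) (fromℕ n)) ⟩
    fromℕ (suc m) - fromℕ (suc n)     ∎

  fromℤ-+ : ∀ m n → fromℤ (m ℤ.+ n) ≈ fromℤ m + fromℤ n
  fromℤ-+ (+ m)    (+ n)    = fromℕ-+ m n
  fromℤ-+ (+ m)    -[1+ n ] = fromℤ-⊖ m (suc n)
  fromℤ-+ -[1+ m ] (+ n)    = trans (fromℤ-⊖ n (suc m)) (+-comm _ _)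
  fromℤ-+ -[1+ m ] -[1+ n ] = begin
    - fromℕ (suc (suc (m ℕ.+ n)))          ≡⟨ ≡.cong (λ k → - fromℕ (suc k)) (+-suc m n) ⟨
    - fromℕ (suc m ℕ.+ suc n)              ≈⟨ -‿cong (fromℕ-+ (suc m) (suc n)) ⟩
    - (fromℕ (suc m) + fromℕ (suc n))      ≈⟨ sym (⁻¹-∙-comm _ _) ⟩
    - fromℕ (suc m) + - fromℕ (suc n)      ∎

  fromℤ-neg : ∀ z → fromℤ (ℤ.- z) ≈ - fromℤ z
  fromℤ-neg (+ zero)  = sym ε⁻¹≈ε
  fromℤ-neg (+ suc n) = refl
  fromℤ-neg -[1+ n ]  = sym (⁻¹-involutive _)

  private
    fromℤ-+◃ : ∀ n → fromℤ (Sign.+ ℤ.◃ n) ≈ fromℕ n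
    fromℤ-+◃ n = reflexive (≡.cong fromℤ (ℤ.+◃n≡+n n))

    fromℤ--◃ : ∀ n → fromℤ (Sign.- ℤ.◃ n) ≈ - fromℕ n
    fromℤ--◃ n = trans (reflexive (≡.cong fromℤ (ℤ.-◃n≡-n n))) (fromℤ-neg (+ n))

  fromℤ-* : ∀ m n → fromℤ (m ℤ.* n) ≈ fromℤ m * fromℤ n
  fromℤ-* (+ m) (+ n) = trans (fromℤ-+◃ (m ℕ.* n)) (fromℕ-* m n)
  fromℤ-* (+ m) -[1+ n ] = begin
    fromℤ (Sign.- ℤ.◃ m ℕ.* suc n)    ≈⟨ fromℤ--◃ (m ℕ.* suc n) ⟩
    - fromℕ (m ℕ.* suc n)             ≈⟨ -‿cong (fromℕ-* m (suc n)) ⟩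
    - (fromℕ m * fromℕ (suc n))       ≈⟨ -‿distribʳ-* _ _ ⟩
    fromℕ m * - fromℕ (suc n)         ∎
  fromℤ-* -[1+ m ] (+ n) = begin
    fromℤ (Sign.- ℤ.◃ suc m ℕ.* n)    ≈⟨ fromℤ--◃ (suc m ℕ.* n) ⟩
    - fromℕ (suc m ℕ.* n)             ≈⟨ -‿cong (fromℕ-* (suc m) n) ⟩
    - (fromℕ (suc m) * fromℕ n)       ≈⟨ -‿distribˡ-* _ _ ⟩
    - fromℕ (suc m) * fromℕ n         ∎
  fromℤ-* -[1+ m ] -[1+ n ] = begin
    fromℤ (Sign.+ ℤ.◃ suc m ℕ.* suc n)    ≈⟨ fromℤ-+◃ (suc m ℕ.* suc n) ⟩
    fromℕ (suc m ℕ.* suc n)               ≈⟨ fromℕ-* (suc m) (suc n) ⟩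
    fromℕ (suc m) * fromℕ (suc n)         ≈⟨ sym (⁻¹-involutive _) ⟩
    - - (fromℕ (suc m) * fromℕ (suc n))   ≈⟨ -‿cong (-‿distribˡ-* _ _) ⟩
    - (- fromℕ (suc m) * fromℕ (suc n))   ≈⟨ -‿distribʳ-* _ _ ⟩
    - fromℕ (suc m) * - fromℕ (suc n)     ∎

  -- The coefficient 1 denotes 1# itself rather than fromℕ 1 = 1# + 0#, so that
  -- evaluated polynomials are definitionally the expressions of Defs, which use 1#.
  embed : ℤ → Carrier
  embed (+ 1) = 1#
  embed z     = fromℤ z

  embed≈fromℤ : ∀ z → embed z ≈ fromℤ z
  embed≈fromℤ (+ 0)           = refl
  embed≈fromℤ (+ 1)           = sym (+-identityʳ 1#)
  embed≈fromℤ (+ suc (suc n)) = refl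
  embed≈fromℤ -[1+ n ]        = refl

  embed-homomorphism : ℤ.+-*-rawRing -Raw-AlmostCommutative⟶ fromCommutativeRing commutativeRing
  embed-homomorphism = record
    { ⟦_⟧    = embed
    ; +-homo = homo₂ ℤ._+_ _+_ +-cong fromℤ-+
    ; *-homo = homo₂ ℤ._*_ _*_ *-cong fromℤ-*
    ; -‿homo = λ z → trans (embed≈fromℤ (ℤ.- z))
                       (trans (fromℤ-neg z) (-‿cong (sym (embed≈fromℤ z))))
    ; 0-homo = refl
    ; 1-homo = refl
    }
    where
    homo₂ : ∀ (_∙_ : ℤ → ℤ → ℤ) (_∘_ : Carrier → Carrier → Carrier) →
            (∀ {x x′ y y′} → x ≈ x′ → y ≈ y′ → (x ∘ y) ≈ (x′ ∘ y′)) →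
            (∀ m n → fromℤ (m ∙ n) ≈ fromℤ m ∘ fromℤ n) →
            ∀ m n → embed (m ∙ n) ≈ embed m ∘ embed n
    homo₂ _∙_ _ ∘-cong homo m n = trans (embed≈fromℤ (m ∙ n))
      (trans (homo m n) (sym (∘-cong (embed≈fromℤ m) (embed≈fromℤ n))))

  embed-≟ : ∀ m n → Maybe.Maybe (embed m ≈ embed n)
  embed-≟ m n = Maybe.map (λ { ≡.refl → refl }) (dec⇒weaklyDec ℤ._≟_ m n)

  open import Algebra.Solver.Ring ℤ.+-*-rawRing (fromCommutativeRing commutativeRing)
    embed-homomorphism embed-≟ public

  κ : ∀ {n} → ℕ → Polynomial n
  κ m = con (+ m)

  carrierSyntax : RingSyntax Carrier
  carrierSyntax = record { _+_ = _+_ ; _*_ = _*_ ; -_ = -_ ; lit = fromℕ }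

  polynomialSyntax : ∀ n → RingSyntax (Polynomial n)
  polynomialSyntax n = record { _+_ = _:+_ ; _*_ = _:*_ ; -_ = :-_ ; lit = κ }

  module ₚ {n : ℕ} = Formulas (polynomialSyntax n)

  ⟦⟧-cong : ∀ {n} (p : Polynomial n) {ρ σ : Vec Carrier n} →
            Pointwise _≈_ ρ σ → ⟦ p ⟧ ρ ≈ ⟦ p ⟧ σ
  ⟦⟧-cong (op [+] p q) ρ≈σ = +-cong (⟦⟧-cong p ρ≈σ) (⟦⟧-cong q ρ≈σ)
  ⟦⟧-cong (op [*] p q) ρ≈σ = *-cong (⟦⟧-cong p ρ≈σ) (⟦⟧-cong q ρ≈σ)
  ⟦⟧-cong (con c)      ρ≈σ = refl
  ⟦⟧-cong (var i)      ρ≈σ = Pointwise.lookup ρ≈σ i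
  ⟦⟧-cong (p :^ k)     ρ≈σ = ^-congˡ k (⟦⟧-cong p ρ≈σ)
  ⟦⟧-cong (:- p)       ρ≈σ = -‿cong (⟦⟧-cong p ρ≈σ)

module Cubics {c ℓ : Level} (F : Field c ℓ)
              (2≉0 : NonzeroNumeral F 2) (3≉0 : NonzeroNumeral F 3) where
  open Field F
  open FieldOps F
  open FieldSolver F
  open FieldProperties F
  open Formulas carrierSyntax public
    using (tschirnhausP; tschirnhausQ; discPQ; affineA; affineB; affineC)
  open import Algebra.Properties.Group +-group using (ε⁻¹≈ε)
  open import Algebra.Properties.Semiring.Exp semiring using (_^_)

  -- The curve z² = t³ + 3 P t + Q has j-invariant j.
  HasJInvariantPQ : Carrier → Carrier → Carrier → Set ℓ
  HasJInvariantPQ P Q j = ¬ discPQ P Q ≈ 0# × j * discPQ P Q ≈ fromℕ 6912 * cube P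

  tschirnhaus-disc : ∀ α β γ δ →
    fromℕ 3 ^ 3 * sq α * disc α β γ δ ≈ - discPQ (tschirnhausP α β γ) (tschirnhausQ α β γ δ)
  tschirnhaus-disc = solve 4 (λ α β γ δ →
    κ 3 :^ 3 :* ₚ.sq α :* ₚ.disc α β γ δ
      := :- ₚ.discPQ (ₚ.tschirnhausP α β γ) (ₚ.tschirnhausQ α β γ δ)) refl

  hasJInvariant⇒PQ : ∀ {α β γ δ j} → ¬ α ≈ 0# → HasJInvariant α β γ δ j →
    HasJInvariantPQ (tschirnhausP α β γ) (tschirnhausQ α β γ δ) j
  hasJInvariant⇒PQ {α} {β} {γ} {δ} {j} α≉0 (disc≉0 , j-eq) = discPQ≉0 , j-eqPQ
    where
    discPQ≉0 : ¬ discPQ (tschirnhausP α β γ) (tschirnhausQ α β γ δ) ≈ 0#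
    discPQ≉0 discPQ≈0 = disc≉0 (x*y≈0⇒y≈0 (*-nonzero (^-nonzero 3≉0 3) (sq-nonzero α≉0))
      (trans (tschirnhaus-disc α β γ δ) (trans (-‿cong discPQ≈0) ε⁻¹≈ε)))

    j-eqPQ : j * discPQ (tschirnhausP α β γ) (tschirnhausQ α β γ δ)
             ≈ fromℕ 6912 * cube (tschirnhausP α β γ)
    j-eqPQ = by-combination
      (solve 5 (λ α β γ δ j →
        j :* ₚ.discPQ (ₚ.tschirnhausP α β γ) (ₚ.tschirnhausQ α β γ δ)
          := κ 6912 :* ₚ.cube (ₚ.tschirnhausP α β γ)
             :+ (:- κ 27) :* (j :* ₚ.sq α :* ₚ.disc α β γ δ
                              :- κ 256 :* ₚ.cube (ₚ.sq β :- κ 3 :* α :* γ)))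
        refl α β γ δ j)
      j-eq

  HasJInvariantPQ-nonzero : ∀ {P Q j} → ¬ j ≈ 0# → ¬ j ≈ fromℕ 1728 →
    HasJInvariantPQ P Q j → ¬ P ≈ 0# × ¬ Q ≈ 0#
  HasJInvariantPQ-nonzero {P} {Q} {j} j≉0 j≉1728 (discPQ≉0 , j-eq) = P≉0 , Q≉0
    where
    P≉0 : ¬ P ≈ 0#
    P≉0 P≈0 = discPQ≉0 (x*y≈0⇒y≈0 j≉0 (by-combination
      (trans j-eq
        (solve 1 (λ P → κ 6912 :* ₚ.cube P := κ 0 :+ κ 6912 :* ₚ.sq P :* (P :- κ 0)) refl P))
      P≈0))

    Q≉0 : ¬ Q ≈ 0#
    Q≉0 Q≈0 = x≉y⇒x-y≉0 j≉1728 (x*y≈0⇒y≈0 (*-nonzero (^-nonzero 2≉0 2) (cube-nonzero P≉0))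
      (by-combination₂
        (solve 3 (λ P Q j →
          κ 2 :^ 2 :* ₚ.cube P :* (j :- κ 1728)
            := κ 0 :+ κ 1 :* (j :* ₚ.discPQ P Q :- κ 6912 :* ₚ.cube P)
                   :+ (:- (j :* Q)) :* (Q :- κ 0))
          refl P Q j)
        j-eq Q≈0))

  HasJInvariantPQ-ratio : ∀ {P Q P′ Q′ j} → ¬ j ≈ 0# →
    HasJInvariantPQ P Q j → HasJInvariantPQ P′ Q′ j → sq Q * cube P′ ≈ sq Q′ * cube P
  HasJInvariantPQ-ratio {P} {Q} {P′} {Q′} {j} j≉0 (_ , j-eq) (_ , j-eq′) = *-cancelˡ j≉0
    (by-combination₂
      (solve 5 (λ P Q P′ Q′ j →
        j :* (ₚ.sq Q :* ₚ.cube P′)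
          := j :* (ₚ.sq Q′ :* ₚ.cube P)
             :+ ₚ.cube P′ :* (j :* ₚ.discPQ P Q :- κ 6912 :* ₚ.cube P)
             :+ (:- ₚ.cube P) :* (j :* ₚ.discPQ P′ Q′ :- κ 6912 :* ₚ.cube P′))
        refl P Q P′ Q′ j)
      j-eq j-eq′)

  equalRatio⇒scaling : ∀ {P Q P′ Q′} →
    ¬ P ≈ 0# → ¬ Q ≈ 0# → ¬ P′ ≈ 0# → ¬ Q′ ≈ 0# → sq Q * cube P′ ≈ sq Q′ * cube P →
    Σ Carrier λ L → ¬ L ≈ 0# × sq L * P ≈ P′ × cube L * Q ≈ Q′
  equalRatio⇒scaling {P} {Q} {P′} {Q′} P≉0 Q≉0 P′≉0 Q′≉0 ratio =
    L , L≉0 , L²P≈P′ , L³Q≈Q′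
    where
    L : Carrier
    L = Q′ * P * (Q * P′) ⁻¹

    LQP′≈Q′P : L * (Q * P′) ≈ Q′ * P
    LQP′≈Q′P = by-combination
      (solve 3 (λ Q′P QP′ w → Q′P :* w :* QP′ := Q′P :+ Q′P :* (QP′ :* w :- κ 1))
        refl (Q′ * P) (Q * P′) ((Q * P′) ⁻¹))
      (⁻¹-inverse (Q * P′) (*-nonzero Q≉0 P′≉0))

    L≉0 : ¬ L ≈ 0#
    L≉0 L≈0 = *-nonzero Q′≉0 P≉0 (trans (sym LQP′≈Q′P) (trans (*-congʳ L≈0) (zeroˡ _)))

    L²P≈P′ : sq L * P ≈ P′
    L²P≈P′ = *-cancelˡ (sq-nonzero (*-nonzero Q≉0 P′≉0))
      (by-combination₂
        (solve 5 (λ L P Q P′ Q′ →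
          ₚ.sq (Q :* P′) :* (ₚ.sq L :* P)
            := ₚ.sq (Q :* P′) :* P′
               :+ (P :* (L :* (Q :* P′) :+ Q′ :* P)) :* (L :* (Q :* P′) :- Q′ :* P)
               :+ (:- κ 1) :* (ₚ.sq Q :* ₚ.cube P′ :- ₚ.sq Q′ :* ₚ.cube P))
          refl L P Q P′ Q′)
        LQP′≈Q′P ratio)

    L³Q≈Q′ : cube L * Q ≈ Q′
    L³Q≈Q′ = *-cancelˡ (*-nonzero P′≉0 P≉0)
      (by-combination₂
        (solve 5 (λ L P Q P′ Q′ →
          P′ :* P :* (ₚ.cube L :* Q)
            := P′ :* P :* Q′
               :+ (L :* Q :* P′) :* (ₚ.sq L :* P :- P′)
               :+ P′ :* (L :* (Q :* P′) :- Q′ :* P))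
          refl L P Q P′ Q′)
        L²P≈P′ LQP′≈Q′P)

  tschirnhausP-affine : ∀ L M a b →
    tschirnhausP 1# (affineA L M a) (affineB L M a b) ≈ sq L * tschirnhausP 1# a b
  tschirnhausP-affine = solve 4 (λ L M a b →
    ₚ.tschirnhausP (κ 1) (ₚ.affineA L M a) (ₚ.affineB L M a b)
      := ₚ.sq L :* ₚ.tschirnhausP (κ 1) a b) refl

  tschirnhausQ-affine : ∀ L M a b c →
    tschirnhausQ 1# (affineA L M a) (affineB L M a b) (affineC L M a b c)
    ≈ cube L * tschirnhausQ 1# a b c
  tschirnhausQ-affine = solve 5 (λ L M a b c →
    ₚ.tschirnhausQ (κ 1) (ₚ.affineA L M a) (ₚ.affineB L M a b) (ₚ.affineC L M a b c)
      := ₚ.cube L :* ₚ.tschirnhausQ (κ 1) a b c) refl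

  monicCubic-unique : ∀ {a b c a′ b′ c′} → a ≈ a′ →
    tschirnhausP 1# a b ≈ tschirnhausP 1# a′ b′ →
    tschirnhausQ 1# a b c ≈ tschirnhausQ 1# a′ b′ c′ → b ≈ b′ × c ≈ c′
  monicCubic-unique {a} {b} {c} {a′} {b′} {c′} a≈a′ P≈P′ Q≈Q′ = b≈b′ , c≈c′
    where
    b≈b′ : b ≈ b′
    b≈b′ = *-cancelˡ 3≉0
      (by-combination₂
        (solve 4 (λ a b a′ b′ →
          κ 3 :* b := κ 3 :* b′
            :+ κ 1 :* (ₚ.tschirnhausP (κ 1) a b :- ₚ.tschirnhausP (κ 1) a′ b′)
            :+ (a :+ a′) :* (a :- a′))
          refl a b a′ b′)
        P≈P′ a≈a′)

    c≈c′ : c ≈ c′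
    c≈c′ = *-cancelˡ (^-nonzero 3≉0 3)
      (by-combination₃
        (solve 6 (λ a b c a′ b′ c′ →
          κ 3 :^ 3 :* c := κ 3 :^ 3 :* c′
            :+ κ 1 :* (ₚ.tschirnhausQ (κ 1) a b c :- ₚ.tschirnhausQ (κ 1) a′ b′ c′)
            :+ (κ 9 :* b :- κ 2 :* (ₚ.sq a :+ a :* a′ :+ ₚ.sq a′)) :* (a :- a′)
            :+ (κ 9 :* a′) :* (b :- b′))
          refl a b c a′ b′ c′)
        Q≈Q′ a≈a′ b≈b′)

  scaling⇒affine : ∀ {L a b c a′ b′ c′} →
    sq L * tschirnhausP 1# a b ≈ tschirnhausP 1# a′ b′ →
    cube L * tschirnhausQ 1# a b c ≈ tschirnhausQ 1# a′ b′ c′ →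
    Σ Carrier λ M → affineA L M a ≈ a′ × affineB L M a b ≈ b′ × affineC L M a b c ≈ c′
  scaling⇒affine {L} {a} {b} {c} {a′} L²P≈P′ L³Q≈Q′ =
    M , a-eq , monicCubic-unique a-eq
                 (trans (tschirnhausP-affine L M a b) L²P≈P′)
                 (trans (tschirnhausQ-affine L M a b c) L³Q≈Q′)
    where
    M : Carrier
    M = (L * a - a′) * fromℕ 3 ⁻¹

    a-eq : affineA L M a ≈ a′
    a-eq = by-combination
      (solve 4 (λ L a a′ t →
        ₚ.affineA L ((L :* a :- a′) :* t) a := a′ :+ (:- (L :* a :- a′)) :* (κ 3 :* t :- κ 1))
        refl L a a′ (fromℕ 3 ⁻¹))
      (⁻¹-inverse (fromℕ 3) 3≉0)

  sameJInvariant⇒affine : ∀ {j a b c a′ b′ c′} → ¬ j ≈ 0# → ¬ j ≈ fromℕ 1728 →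
    HasJInvariantPQ (tschirnhausP 1# a b) (tschirnhausQ 1# a b c) j →
    HasJInvariantPQ (tschirnhausP 1# a′ b′) (tschirnhausQ 1# a′ b′ c′) j →
    Σ Carrier λ L → ¬ L ≈ 0# × Σ Carrier λ M →
      affineA L M a ≈ a′ × affineB L M a b ≈ b′ × affineC L M a b c ≈ c′
  sameJInvariant⇒affine j≉0 j≉1728 hasJ hasJ′ =
    let P≉0 , Q≉0   = HasJInvariantPQ-nonzero j≉0 j≉1728 hasJ
        P′≉0 , Q′≉0 = HasJInvariantPQ-nonzero j≉0 j≉1728 hasJ′
        L , L≉0 , L²P≈P′ , L³Q≈Q′ =
          equalRatio⇒scaling P≉0 Q≉0 P′≉0 Q′≉0 (HasJInvariantPQ-ratio j≉0 hasJ hasJ′)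
    in L , L≉0 , scaling⇒affine L²P≈P′ L³Q≈Q′

module DepressedQuartic {c ℓ : Level} (F : Field c ℓ)
              (2≉0 : NonzeroNumeral F 2) (3≉0 : NonzeroNumeral F 3) where
  open Field F
  open FieldOps F
  open FieldSolver F
  open FieldProperties F
  open Cubics F 2≉0 3≉0
  open Formulas carrierSyntax public
    using (weierstrassA; weierstrassB; depressedCvA; depressedCvB; depressedCvC)
  open import Algebra.Properties.Group +-group using (ε⁻¹≈ε)
  open import Algebra.Properties.Semiring.Exp semiring using (_^_)

  4≉0 : ¬ fromℕ 4 ≈ 0#
  4≉0 = *-nonzero 2≉0 2≉0 ∘ trans (sym (fromℕ-* 2 2))

  -- f = L (x⁴ + 2 A x² + 4 B x) + M has f′ = 4 L (x³ + A x + B).  Defs computes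
  -- p, q, r = 0, A, B of f′ / (4 L) through an inverse, so they are first replaced
  -- by variables and then substituted.
  depressedQuartic-criticalValues : ∀ A B L M → ¬ L ≈ 0# →
    let a₂ = fromℕ 2 * A * L ; a₁ = fromℕ 4 * B * L
        c₂ = depressedCvA A B ; c₁ = depressedCvB A B ; c₀ = depressedCvC A B in
    cvA L 0# a₂ a₁ M ≈ affineA L M c₂ × cvB L 0# a₂ a₁ M ≈ affineB L M c₂ c₁ ×
    cvC L 0# a₂ a₁ M ≈ affineC L M c₂ c₁ c₀
  depressedQuartic-criticalValues A B L M L≉0 =
    trans (⟦⟧-cong Generic.cvA pqr≈0AB)
      (solve 4 (λ A B L M → Specialised.cvA A B L M := ₚ.affineA L M (ₚ.depressedCvA A B))
        refl A B L M) ,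
    trans (⟦⟧-cong Generic.cvB pqr≈0AB)
      (solve 4 (λ A B L M → Specialised.cvB A B L M
                  := ₚ.affineB L M (ₚ.depressedCvA A B) (ₚ.depressedCvB A B))
        refl A B L M) ,
    trans (⟦⟧-cong Generic.cvC pqr≈0AB)
      (solve 4 (λ A B L M → Specialised.cvC A B L M
                  := ₚ.affineC L M (ₚ.depressedCvA A B) (ₚ.depressedCvB A B) (ₚ.depressedCvC A B))
        refl A B L M)
    where
    module Depressed {n} (p q r A B L M : Polynomial n) =
      ₚ.CriticalValues p q r L (κ 0) (κ 2 :* A :* L) (κ 4 :* B :* L) M
    module Generic =
      Depressed (var (# 0)) (var (# 1)) (var (# 2)) (var (# 3)) (var (# 4)) (var (# 5)) (var (# 6))
    module Specialised {n} (A B L M : Polynomial n) = Depressed (κ 0) A B A B L M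

    w : Carrier
    w = (fromℕ 4 * L) ⁻¹

    4Lw≈1 : fromℕ 4 * L * w ≈ 1#
    4Lw≈1 = ⁻¹-inverse (fromℕ 4 * L) (*-nonzero 4≉0 L≉0)

    pqr≈0AB : Pointwise _≈_
      (fromℕ 3 * 0# * w ∷ fromℕ 2 * (fromℕ 2 * A * L) * w ∷ fromℕ 4 * B * L * w
        ∷ A ∷ B ∷ L ∷ M ∷ [])
      (0# ∷ A ∷ B ∷ A ∷ B ∷ L ∷ M ∷ [])
    pqr≈0AB =
      trans (*-congʳ (zeroʳ _)) (zeroˡ _) ∷
      by-combination
        (solve 3 (λ A L w → κ 2 :* (κ 2 :* A :* L) :* w := A :+ A :* (κ 4 :* L :* w :- κ 1))
          refl A L w)
        4Lw≈1 ∷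
      by-combination
        (solve 3 (λ B L w → κ 4 :* B :* L :* w := B :+ B :* (κ 4 :* L :* w :- κ 1))
          refl B L w)
        4Lw≈1 ∷
      Pointwise.refl refl

  depressedQuartic-criticalPoints-jInvariant : ∀ {j L} →
    ¬ j ≈ 0# → ¬ j ≈ fromℕ 1728 → ¬ L ≈ 0# →
    HasJInvariant (fromℕ 4 * L) (fromℕ 3 * 0#)
                  (fromℕ 2 * (fromℕ 2 * weierstrassA j * L)) (fromℕ 4 * weierstrassB j * L) j
  depressedQuartic-criticalPoints-jInvariant {j} {L} j≉0 j≉1728 L≉0 = disc≉0 , j-eq
    where
    α β γ δ : Carrier
    α = fromℕ 4 * L
    β = fromℕ 3 * 0#
    γ = fromℕ 2 * (fromℕ 2 * weierstrassA j * L)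
    δ = fromℕ 4 * weierstrassB j * L

    disc-eq : disc α β γ δ ≈ fromℕ 2 ^ 8 * fromℕ 3 ^ 6 * α ^ 4 * j ^ 2 * (j - fromℕ 1728) ^ 3
    disc-eq = solve 2 (λ j L →
      ₚ.disc (κ 4 :* L) (κ 3 :* κ 0)
             (κ 2 :* (κ 2 :* ₚ.weierstrassA j :* L)) (κ 4 :* ₚ.weierstrassB j :* L)
        := κ 2 :^ 8 :* κ 3 :^ 6 :* (κ 4 :* L) :^ 4 :* j :^ 2 :* (j :- κ 1728) :^ 3)
      refl j L

    disc≉0 : ¬ disc α β γ δ ≈ 0#
    disc≉0 = *-nonzero (*-nonzero (*-nonzero (*-nonzero (^-nonzero 2≉0 8) (^-nonzero 3≉0 6))
                                             (^-nonzero (*-nonzero 4≉0 L≉0) 4))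
                                  (^-nonzero j≉0 2))
                       (^-nonzero (x≉y⇒x-y≉0 j≉1728) 3)
             ∘ trans (sym disc-eq)

    j-eq : j * sq α * disc α β γ δ ≈ fromℕ 256 * cube (sq β - fromℕ 3 * α * γ)
    j-eq = solve 2 (λ j L →
      let α = κ 4 :* L ; β = κ 3 :* κ 0 ; γ = κ 2 :* (κ 2 :* ₚ.weierstrassA j :* L)
          δ = κ 4 :* ₚ.weierstrassB j :* L in
      j :* ₚ.sq α :* ₚ.disc α β γ δ := κ 256 :* ₚ.cube (ₚ.sq β :- κ 3 :* α :* γ))
      refl j L

  jMapFibre⇒j≉0 : ∀ {jCV j} → ¬ jCV ≈ 0# → ¬ j ≈ fromℕ 1728 →
    j * cube (j - fromℕ 1536) ≈ fromℕ 262144 * jCV * (j - fromℕ 1728) → ¬ j ≈ 0#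
  jMapFibre⇒j≉0 {jCV} {j} jCV≉0 j≉1728 j-map j≈0 =
    *-nonzero (*-nonzero 2¹⁸≉0 jCV≉0) (x≉y⇒x-y≉0 j≉1728)
      (trans (sym j-map) (trans (*-congʳ j≈0) (zeroˡ _)))
    where
    2¹⁸≉0 : ¬ fromℕ 262144 ≈ 0#
    2¹⁸≉0 = ^-nonzero 2≉0 18 ∘ trans (solve 0 (κ 2 :^ 18 := κ 262144) refl)

  depressedQuartic-criticalValues-jInvariant : ∀ {jCV j} → ¬ j ≈ 0# → ¬ j ≈ fromℕ 1728 →
    j * cube (j - fromℕ 1536) ≈ fromℕ 262144 * jCV * (j - fromℕ 1728) →
    let A = weierstrassA j ; B = weierstrassB j
        c₂ = depressedCvA A B ; c₁ = depressedCvB A B ; c₀ = depressedCvC A B in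
    HasJInvariantPQ (tschirnhausP 1# c₂ c₁) (tschirnhausQ 1# c₂ c₁ c₀) jCV
  depressedQuartic-criticalValues-jInvariant {jCV} {j} j≉0 j≉1728 j-map = discPQ≉0 , jCV-eq
    where
    A B c₂ c₁ c₀ P Q : Carrier
    A = weierstrassA j
    B = weierstrassB j
    c₂ = depressedCvA A B
    c₁ = depressedCvB A B
    c₀ = depressedCvC A B
    P = tschirnhausP 1# c₂ c₁
    Q = tschirnhausQ 1# c₂ c₁ c₀

    discPQ-eq : - discPQ P Q ≈ fromℕ 2 ^ 26 * fromℕ 3 ^ 21 * j ^ 8 * (j - fromℕ 1728) ^ 13
    discPQ-eq = solve 1 (λ j →
      let A = ₚ.weierstrassA j ; B = ₚ.weierstrassB j
          c₂ = ₚ.depressedCvA A B ; c₁ = ₚ.depressedCvB A B ; c₀ = ₚ.depressedCvC A B in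
      :- ₚ.discPQ (ₚ.tschirnhausP (κ 1) c₂ c₁) (ₚ.tschirnhausQ (κ 1) c₂ c₁ c₀)
        := κ 2 :^ 26 :* κ 3 :^ 21 :* j :^ 8 :* (j :- κ 1728) :^ 13)
      refl j

    discPQ≉0 : ¬ discPQ P Q ≈ 0#
    discPQ≉0 discPQ≈0 =
      *-nonzero (*-nonzero (*-nonzero (^-nonzero 2≉0 26) (^-nonzero 3≉0 21)) (^-nonzero j≉0 8))
                (^-nonzero (x≉y⇒x-y≉0 j≉1728) 13)
        (trans (sym discPQ-eq) (trans (-‿cong discPQ≈0) ε⁻¹≈ε))

    jCV-eq : jCV * discPQ P Q ≈ fromℕ 6912 * cube P
    jCV-eq = by-combination
      (solve 2 (λ j jCV →
        let A = ₚ.weierstrassA j ; B = ₚ.weierstrassB j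
            c₂ = ₚ.depressedCvA A B ; c₁ = ₚ.depressedCvB A B ; c₀ = ₚ.depressedCvC A B
            P = ₚ.tschirnhausP (κ 1) c₂ c₁ ; Q = ₚ.tschirnhausQ (κ 1) c₂ c₁ c₀ in
        jCV :* ₚ.discPQ P Q
          := κ 6912 :* ₚ.cube P
             :+ κ 2 :^ 8 :* κ 3 :^ 21 :* j :^ 8 :* (j :- κ 1728) :^ 12
                :* (j :* ₚ.cube (j :- κ 1536) :- κ 262144 :* jCV :* (j :- κ 1728)))
        refl j jCV)
      j-map

lemma4p3 : ∀ {c ℓ : Level} (K : NumberField c ℓ) → let open NumberField K in
    (jCV : Carrier) → ¬ (jCV ≈ 0#) → ¬ (jCV ≈ fromℕ 1728) →
    (j : Carrier) → ¬ (j ≈ fromℕ 1728) →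
    (j * cube (j - fromℕ 1536) ≈ fromℕ 262144 * jCV * (j - fromℕ 1728)) →
    (a b c₀ : Carrier) →
    HasJInvariant 1# a b c₀ jCV →
    Σ Carrier λ a₄ → Σ Carrier λ a₃ → Σ Carrier λ a₂ → Σ Carrier λ a₁ → Σ Carrier λ a₀ →
      ¬ (a₄ ≈ 0#) ×
      (cvA a₄ a₃ a₂ a₁ a₀ ≈ a) × (cvB a₄ a₃ a₂ a₁ a₀ ≈ b) × (cvC a₄ a₃ a₂ a₁ a₀ ≈ c₀) ×
      HasJInvariant (fromℕ 4 * a₄) (fromℕ 3 * a₃) (fromℕ 2 * a₂) a₁ j
lemma4p3 K jCV jCV≉0 jCV≉1728 j j≉1728 j-map a b c₀ hasJ =
  let L , L≉0 , M , a-eq , b-eq , c-eq =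
        sameJInvariant⇒affine jCV≉0 jCV≉1728
          (depressedQuartic-criticalValues-jInvariant j≉0 j≉1728 j-map)
          (hasJInvariant⇒PQ (0≉1 ∘ sym) hasJ)
      cvA-eq , cvB-eq , cvC-eq = depressedQuartic-criticalValues A B L M L≉0
  in L , 0# , fromℕ 2 * A * L , fromℕ 4 * B * L , M , L≉0 ,
     trans cvA-eq a-eq , trans cvB-eq b-eq , trans cvC-eq c-eq ,
     depressedQuartic-criticalPoints-jInvariant j≉0 j≉1728 L≉0
  where
  open NumberField K
  open Cubics field′ (charZero 1) (charZero 2)
  open DepressedQuartic field′ (charZero 1) (charZero 2)

  A B : Carrier
  A = weierstrassA j
  B = weierstrassB j

  j≉0 : ¬ j ≈ 0#
  j≉0 = jMapFibre⇒j≉0 jCV≉0 j≉1728 j-map
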